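{- Let $H_1,\dots,H_l$ be special graphs (not necessarily equal), where $H_i$ has vertex set $B_i$ and special pair $u_i,v_i$, and let $G_l$ be the graph obtained from the disjoint union of $H_1,\dots,H_l$ by adding the edges $\{v_i,u_{i+1}\}$ for $i=1,\dots,l-1$. Let $k\in\mathbb{Z}^+$, $r\in\{0,1,2\}$ and $l=3k+r$. Then $$\pi^*(G_{3k+r})\le\begin{cases}8k&\text{if } r=0,\\ 8k+4&\text{if } r=1,\\ 8k+6&\text{if } r=2.\end{cases}$$
   Context: A vertex set $S$ dominates a graph $H$ if every vertex of $H$ is in $S$ or adjacent to a vertex of $S$; an edge dominates $H$ if its endpoints do. A graph $H$ is special if: (1) $H$ has diameter two; (2) $H$ has no dominating edge; (3) $H$ has two vertices $u,v$ (a special pair) such that (a) $d(u,v)=2$, (b) neither $H-u$ nor $H-v$ has a dominating edge, (c) $(N(u)\cap N(v))\cup\{u,v\}$ dominates $H$. Pebbling: a distribution $D:V(G)\to\mathbb{Z}_{\ge0}$ has size $\sum_vD(v)$; a pebbling move removes two pebbles from a vertex and adds one to an adjacent vertex; $v$ is reachable if a sequence of legal moves puts a pebble on $v$; $D$ is solvable if all vertices are reachable; $\pi^*(G)$ is the minimum size of a solvable distribution. -}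

module Defs where

open import Data.Nat using (ℕ; zero; suc; _+_; _*_; _≤_)
open import Data.Fin using (Fin; toℕ)
open import Data.Bool using (Bool; T)
open import Data.List using (List; map; allFin)
open import Data.Nat.ListAction using (sum)
open import Data.Product using (Σ; ∃; ∃-syntax; _×_; _,_)
open import Data.Sum using (_⊎_)
open import Relation.Nullary using (¬_)
open import Relation.Binary.PropositionalEquality using (_≡_; _≢_)

record Graph : Set where
  field
    n      : ℕ
    adj    : Fin n → Fin n → Bool
    sym    : ∀ x y → adj x y ≡ adj y x
    irrefl : ∀ x → ¬ T (adj x x)

  Vertex : Set
  Vertex = Fin n

  Adj : Vertex → Vertex → Set
  Adj x y = T (adj x y)

open Graph public using (Vertex; Adj)

module _ (H : Graph) where
  open Graph H using (n)

  DistLe2 : Vertex H → Vertex H → Set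
  DistLe2 x y = x ≡ y ⊎ Adj H x y ⊎ ∃[ z ] (Adj H x z × Adj H z y)

  Dist2 : Vertex H → Vertex H → Set
  Dist2 x y = x ≢ y × ¬ Adj H x y × ∃[ z ] (Adj H x z × Adj H z y)

  DiameterTwo : Set
  DiameterTwo = (∀ x y → DistLe2 x y) × ∃[ x ] ∃[ y ] Dist2 x y

  DominatingEdge : Vertex H → Vertex H → Set
  DominatingEdge x y =
    Adj H x y × (∀ z → z ≡ x ⊎ z ≡ y ⊎ Adj H z x ⊎ Adj H z y)

  HasDominatingEdge : Set
  HasDominatingEdge = ∃[ x ] ∃[ y ] DominatingEdge x y

  -- H - w has a dominating edge (an edge of H avoiding w that dominates
  -- every vertex other than w)
  HasDominatingEdgeMinus : Vertex H → Set
  HasDominatingEdgeMinus w =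
    ∃[ x ] ∃[ y ] (x ≢ w × y ≢ w × Adj H x y ×
      (∀ z → z ≢ w → z ≡ x ⊎ z ≡ y ⊎ Adj H z x ⊎ Adj H z y))

  InS : Vertex H → Vertex H → Vertex H → Set
  InS u v s = s ≡ u ⊎ s ≡ v ⊎ (Adj H s u × Adj H s v)

  record SpecialPair (u v : Vertex H) : Set where
    field
      dist-uv      : Dist2 u v
      noDomMinusU  : ¬ HasDominatingEdgeMinus u
      noDomMinusV  : ¬ HasDominatingEdgeMinus v
      dominates    : ∀ z → InS u v z ⊎ ∃[ s ] (InS u v s × Adj H z s)

  record IsSpecial (u v : Vertex H) : Set where
    field
      diam2   : DiameterTwo
      noDom   : ¬ HasDominatingEdge
      special : SpecialPair u v

module Pebbling {V : Set} (A : V → V → Set) where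

  Distribution : Set
  Distribution = V → ℕ

  Move : Distribution → Distribution → V → V → Set
  Move D D' x y =
    A x y × D' x + 2 ≡ D x × D' y ≡ suc (D y) ×
    (∀ z → z ≢ x → z ≢ y → D' z ≡ D z)

  data Reachable (D : Distribution) (t : V) : Set where
    here : 1 ≤ D t → Reachable D t
    step : ∀ {D' x y} → Move D D' x y → Reachable D' t → Reachable D t

  Solvable : Distribution → Set
  Solvable D = ∀ t → Reachable D t

module Chain {l : ℕ} (H : Fin l → Graph)
             (u v : (i : Fin l) → Vertex (H i)) where

  GVertex : Set
  GVertex = Σ (Fin l) (λ i → Vertex (H i))

  data GAdj : GVertex → GVertex → Set where
    inner : ∀ {i x y} → Adj (H i) x y → GAdj (i , x) (i , y)
    link  : ∀ {i j} → toℕ j ≡ suc (toℕ i) → GAdj (i , v i) (j , u j)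
    link' : ∀ {i j} → toℕ j ≡ suc (toℕ i) → GAdj (j , u j) (i , v i)

  open Pebbling GAdj public

  size : Distribution → ℕ
  size D = sum (map (λ i → sum (map (λ x → D (i , x)) (allFin (Graph.n (H i)))))
                    (allFin l))

  OptPebLe : ℕ → Set
  OptPebLe b = ∃[ D ] (Solvable D × size D ≤ b)

bound : ℕ → Fin 3 → ℕ
bound k Fin.zero = 8 * k
bound k (Fin.suc Fin.zero) = 8 * k + 4
bound k (Fin.suc (Fin.suc Fin.zero)) = 8 * k + 6

module Submission where

-- Number the blocks H_0, …, H_{l-1} and give block i a role by i mod 3:
-- a sourceV block (i ≡ 0) gets four pebbles on v_i, a sourceU block
-- (i ≡ 2) four pebbles on u_i, and a hub block (i ≡ 1) nothing, except
-- two pebbles on u_i when it is the last block.  Four pebbles on one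
-- vertex reach every vertex within distance two, so diameter two makes
-- the source blocks reachable.  A hub block sits after a sourceV block,
-- whose v is adjacent to its u.  If it is last, two moves give u four
-- pebbles.  Otherwise a sourceU block follows, whose u is adjacent to its
-- v; every vertex is dominated by u, v or a common neighbour s of u and
-- v, and s can collect one pebble from each side.  Every three blocks
-- cost 8 pebbles, which gives 8k, 8k + 4, 8k + 6 for 3k, 3k + 1, 3k + 2
-- blocks.

open import Defs
open import Data.Nat using (ℕ; zero; suc; _+_; _*_; _∸_; _≤_; _<_; z≤n; s≤s; _≡ᵇ_; _<?_)
open import Data.Nat.Properties
  using ( ≤-refl; ≤-trans; ≤-reflexive; ≤-antisym; ≮⇒≥; n≤1+n; n<1+n; <-trans; m≤m+n; m≤n+m∸n
        ; +-cancelˡ-≤; +-monoʳ-≤; *-suc; m∸n+n≡m; +-suc; +-identityʳ; 1+n≢n; m≢1+n+m; ≡⇒≡ᵇ )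
open import Data.Nat.Tactic.RingSolver using (solve-∀)
open import Data.Bool using (Bool; T; if_then_else_)
open import Data.Bool.Properties using (T-≡)
open import Data.Fin using (Fin; toℕ; fromℕ<)
import Data.Fin as Fin
open import Data.Fin.Properties using (toℕ-fromℕ<; toℕ<n) renaming (_≟_ to _≟ᶠ_)
open import Data.List using (map; allFin; tabulate; applyUpTo)
open import Data.List.Properties using (map-tabulate)
open import Data.Nat.ListAction using (sum)
open import Data.Product using (∃-syntax; Σ-syntax; _×_; _,_; proj₁)
open import Data.Product.Properties using (≡-dec; ,-injectiveˡ; ,-injectiveʳ-UIP)
open import Data.Sum using (_⊎_; inj₁; inj₂)
open import Function using (_∋_)
open import Function.Bundles using (Equivalence)
open import Relation.Nullary using (yes; no; contradiction)
open import Relation.Binary.Definitions using (DecidableEquality)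
open import Relation.Binary.PropositionalEquality
open import Axiom.UniquenessOfIdentityProofs using (module Decidable⇒UIP)

module Moves {V : Set} (A : V → V → Set) (_≟_ : DecidableEquality V)
             (adj⇒≢ : ∀ {x y} → A x y → x ≢ y) where
  open Pebbling A

  moveTo : Distribution → V → V → Distribution
  moveTo D x y z with z ≟ x | z ≟ y
  ... | yes _ | _     = D x ∸ 2
  ... | no _  | yes _ = suc (D y)
  ... | no _  | no _  = D z

  moveTo-source : ∀ D x y → moveTo D x y x ≡ D x ∸ 2
  moveTo-source D x y with x ≟ x
  ... | yes _ = refl
  ... | no x≢x = contradiction refl x≢x

  moveTo-target : ∀ D x y → x ≢ y → moveTo D x y y ≡ suc (D y)
  moveTo-target D x y x≢y with y ≟ x | y ≟ y
  ... | yes y≡x | _     = contradiction (sym y≡x) x≢y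
  ... | no _    | yes _ = refl
  ... | no _    | no y≢y = contradiction refl y≢y

  moveTo-other : ∀ D x y z → z ≢ x → z ≢ y → moveTo D x y z ≡ D z
  moveTo-other D x y z z≢x z≢y with z ≟ x | z ≟ y
  ... | yes z≡x | _     = contradiction z≡x z≢x
  ... | no _    | yes z≡y = contradiction z≡y z≢y
  ... | no _    | no _  = refl

  Keeps : Distribution → Distribution → V → Set
  Keeps D D' x = ∀ z → z ≢ x → D z ≤ D' z

  moveTo-keeps : ∀ D x y → Keeps D (moveTo D x y) x
  moveTo-keeps D x y z z≢x with z ≟ x | z ≟ y
  ... | yes z≡x | _        = contradiction z≡x z≢x
  ... | no _    | yes refl = n≤1+n (D z)
  ... | no _    | no _     = ≤-refl

  move : ∀ {D x y} → A x y → 2 ≤ D x → Move D (moveTo D x y) x y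
  move {D} {x} {y} xy 2≤Dx =
    xy , trans (cong (_+ 2) (moveTo-source D x y)) (m∸n+n≡m 2≤Dx)
       , moveTo-target D x y (adj⇒≢ xy)
       , moveTo-other D x y

  -- n moves along the edge xy, which cost 2n pebbles on x, put n extra
  -- pebbles on y and take nothing from the other vertices
  moves : ∀ n {D x y t} → A x y → 2 * n ≤ D x →
          (∀ {D'} → Keeps D D' x → n + D y ≤ D' y → Reachable D' t) →
          Reachable D t
  moves zero xy _ k = k (λ _ _ → ≤-refl) ≤-refl
  moves (suc n) {D} {x} {y} xy 2n+2≤Dx k =
    step (move xy (≤-trans (m≤m+n 2 (2 * n)) 2+2n≤Dx))
      (moves n xy 2n≤D₁x λ {D'} keep y′ →
        k (λ z z≢x → ≤-trans (moveTo-keeps D x y z z≢x) (keep z z≢x))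
          (subst (_≤ D' y) (trans (cong (n +_) (moveTo-target D x y (adj⇒≢ xy))) (+-suc n (D y))) y′))
    where
    2+2n≤Dx : 2 + 2 * n ≤ D x
    2+2n≤Dx = subst (_≤ D x) (*-suc 2 n) 2n+2≤Dx
    2n≤D₁x : 2 * n ≤ moveTo D x y x
    2n≤D₁x = +-cancelˡ-≤ 2 _ _ (≤-trans 2+2n≤Dx
               (subst (λ m → D x ≤ 2 + m) (sym (moveTo-source D x y)) (m≤n+m∸n (D x) 2)))

  reach-adj : ∀ {D x t} → A x t → 2 ≤ D x → Reachable D t
  reach-adj xt 2≤Dx = moves 1 xt 2≤Dx λ _ t₁ → here (≤-trans (s≤s z≤n) t₁)

  Within2 : V → V → Set
  Within2 x t = x ≡ t ⊎ A x t ⊎ ∃[ m ] (A x m × A m t)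

  reach-within2 : ∀ {D x t} → 4 ≤ D x → Within2 x t → Reachable D t
  reach-within2 4≤Dx (inj₁ refl) = here (≤-trans (s≤s z≤n) 4≤Dx)
  reach-within2 4≤Dx (inj₂ (inj₁ xt)) = reach-adj xt (≤-trans (s≤s (s≤s z≤n)) 4≤Dx)
  reach-within2 4≤Dx (inj₂ (inj₂ (m , xm , mt))) =
    moves 2 xm 4≤Dx λ _ m₂ → reach-adj mt (≤-trans (m≤m+n 2 _) m₂)

  -- four pebbles on each of x and y, with paths x a s and y b s, put two
  -- pebbles on s and hence reach every neighbour t of s
  converge : ∀ {D x a y b s t} → A x a → A a s → A y b → A b s → A s t →
             4 ≤ D x → 4 ≤ D y → y ≢ x → y ≢ a → s ≢ y → Reachable D t
  converge xa as yb bs st 4≤Dx 4≤Dy y≢x y≢a s≢y =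
    moves 2 xa 4≤Dx λ keep₁ a₁ →
    moves 1 as (≤-trans (m≤m+n 2 _) a₁) λ keep₂ s₂ →
    moves 2 yb (≤-trans 4≤Dy (≤-trans (keep₁ _ y≢x) (keep₂ _ y≢a))) λ keep₃ b₃ →
    moves 1 bs (≤-trans (m≤m+n 2 _) b₃) λ _ s₄ →
    reach-adj st (≤-trans (s≤s (≤-trans (≤-trans (s≤s z≤n) s₂) (keep₃ _ s≢y))) s₄)

data Role : Set where
  sourceV : Role
  hub     : Role
  sourceU : Role

role : ℕ → Role
role 0 = sourceV
role 1 = hub
role 2 = sourceU
role (suc (suc (suc m))) = role m

hub-prev : ∀ m → role m ≡ hub → ∃[ p ] (m ≡ suc p × role p ≡ sourceV)
hub-prev 1 _ = 0 , refl , refl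
hub-prev (suc (suc (suc m))) e with hub-prev m e
... | p , refl , rp = suc (suc (suc p)) , refl , rp

hub-next : ∀ m → role m ≡ hub → role (suc m) ≡ sourceU
hub-next 1 _ = refl
hub-next (suc (suc (suc m))) e = hub-next m e

-- pebbles on a block of the given role; a hub gets two pebbles only when
-- it is the last block (and so has no sourceU block after it)
stock : Role → (last : Bool) → ℕ
stock sourceV _ = 4
stock hub last = if last then 2 else 0
stock sourceU _ = 4

weight : ℕ → ℕ → ℕ
weight l m = stock (role m) (suc m ≡ᵇ l)

cost : ℕ → ℕ
cost l = sum (applyUpTo (weight l) l)

cost-periodic : ∀ l → cost (3 + l) ≡ 8 + cost l
cost-periodic l = refl

cost-bound : ∀ k (r : Fin 3) → cost (3 * k + toℕ r) ≡ bound k r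
cost-bound k r = trans (cost-blocks k (toℕ r)) (tail r)
  where
  cost-blocks : ∀ k r → cost (3 * k + r) ≡ 8 * k + cost r
  cost-blocks zero r = refl
  cost-blocks (suc k) r = begin
    cost (3 * suc k + r)   ≡⟨ cong cost (shift k r) ⟩
    cost (3 + (3 * k + r)) ≡⟨ cost-periodic (3 * k + r) ⟩
    8 + cost (3 * k + r)   ≡⟨ cong (8 +_) (cost-blocks k r) ⟩
    8 + (8 * k + cost r)   ≡⟨ grow k (cost r) ⟩
    8 * suc k + cost r     ∎
    where
    open ≡-Reasoning
    shift : ∀ k r → 3 * suc k + r ≡ 3 + (3 * k + r)
    shift = solve-∀
    grow : ∀ k c → 8 + (8 * k + c) ≡ 8 * suc k + c
    grow = solve-∀
  tail : ∀ r → 8 * k + cost (toℕ r) ≡ bound k r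
  tail Fin.zero = +-identityʳ (8 * k)
  tail (Fin.suc Fin.zero) = refl
  tail (Fin.suc (Fin.suc Fin.zero)) = refl

point : ∀ {n} → Fin n → ℕ → Fin n → ℕ
point Fin.zero    c Fin.zero    = c
point Fin.zero    c (Fin.suc x) = 0
point (Fin.suc w) c Fin.zero    = 0
point (Fin.suc w) c (Fin.suc x) = point w c x

point-self : ∀ {n} (w : Fin n) c → point w c w ≡ c
point-self Fin.zero c = refl
point-self (Fin.suc w) c = point-self w c

sum-zeros : ∀ n → sum (tabulate {n = n} (λ _ → 0)) ≡ 0
sum-zeros zero = refl
sum-zeros (suc n) = sum-zeros n

sum-point : ∀ {n} (w : Fin n) c → sum (map (point w c) (allFin n)) ≡ c
sum-point {n} w c = trans (cong sum (map-tabulate (λ x → x) (point w c))) (go w)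
  where
  go : ∀ {n} (w : Fin n) → sum (tabulate (point w c)) ≡ c
  go {suc n} Fin.zero = trans (cong (c +_) (sum-zeros n)) (+-identityʳ c)
  go (Fin.suc w) = go w

sum-allFin : ∀ n (f : Fin n → ℕ) (g : ℕ → ℕ) → (∀ i → f i ≡ g (toℕ i)) →
             sum (map f (allFin n)) ≡ sum (applyUpTo g n)
sum-allFin n f g f≗g = trans (cong sum (map-tabulate (λ x → x) f)) (go n f g f≗g)
  where
  go : ∀ n (f : Fin n → ℕ) (g : ℕ → ℕ) → (∀ i → f i ≡ g (toℕ i)) →
       sum (tabulate f) ≡ sum (applyUpTo g n)
  go zero f g _ = refl
  go (suc n) f g f≗g =
    cong₂ _+_ (f≗g Fin.zero) (go n (λ i → f (Fin.suc i)) (λ m → g (suc m)) (λ i → f≗g (Fin.suc i)))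

module ChainPebbling {l : ℕ} (H : Fin l → Graph)
                     (u v : (i : Fin l) → Vertex (H i))
                     (special : ∀ i → IsSpecial (H i) (u i) (v i)) where
  open Chain H u v

  _≟_ : DecidableEquality GVertex
  _≟_ = ≡-dec _≟ᶠ_ (λ {i} → _≟ᶠ_ {Graph.n (H i)})

  adj⇒≢ : ∀ {x y} → GAdj x y → x ≢ y
  adj⇒≢ {i , x} (inner xy) eq =
    Graph.irrefl (H i) x (subst (Adj (H i) x) (sym (,-injectiveʳ-UIP (Decidable⇒UIP.≡-irrelevant _≟ᶠ_) eq)) xy)
  adj⇒≢ (link j≡1+i) eq = 1+n≢n (sym (trans (cong toℕ (,-injectiveˡ eq)) j≡1+i))
  adj⇒≢ (link' j≡1+i) eq = 1+n≢n (trans (sym j≡1+i) (cong toℕ (,-injectiveˡ eq)))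

  open Moves GAdj _≟_ adj⇒≢

  blocks-differ : ∀ {i j x y} → toℕ i ≢ toℕ j → (GVertex ∋ (i , x)) ≢ (j , y)
  blocks-differ i≢j eq = i≢j (cong toℕ (,-injectiveˡ eq))

  blockAt : ∀ {m} → m < l → Σ[ i ∈ Fin l ] (toℕ i ≡ m)
  blockAt m<l = fromℕ< m<l , toℕ-fromℕ< m<l

  adjSym : ∀ {i x y} → Adj (H i) x y → GAdj (i , y) (i , x)
  adjSym {i} {x} {y} xy = inner (subst T (Graph.sym (H i) x y) xy)

  -- each block has diameter two, so four pebbles anywhere in it reach all of it
  reach-block : ∀ {E} i w z → 4 ≤ E (i , w) → Reachable E (i , z)
  reach-block i w z 4≤Ew = reach-within2 4≤Ew (within (proj₁ (IsSpecial.diam2 (special i)) w z))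
    where
    within : DistLe2 (H i) w z → Within2 (i , w) (i , z)
    within (inj₁ refl) = inj₁ refl
    within (inj₂ (inj₁ wz)) = inj₂ (inj₁ (inner wz))
    within (inj₂ (inj₂ (m , wm , mz))) = inj₂ (inj₂ ((i , m) , inner wm , inner mz))

  -- a last hub block i after a sourceV block j: two moves bring the four
  -- pebbles on v_j to u_i, which then holds four pebbles
  reach-last-hub : ∀ {E} (j i : Fin l) → toℕ i ≡ suc (toℕ j) →
                   4 ≤ E (j , v j) → 2 ≤ E (i , u i) → ∀ z → Reachable E (i , z)
  reach-last-hub {E} j i i≡1+j 4≤Ev 2≤Eu z =
    moves 2 (link i≡1+j) 4≤Ev λ _ u₂ → reach-block i (u i) z (≤-trans (+-monoʳ-≤ 2 2≤Eu) u₂)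

  -- a hub block i between a sourceV block j and a sourceU block k: the
  -- pebbles on v_j and u_k are at distance one from u_i and v_i
  -- respectively, and the special pair (u_i, v_i) dominates H_i through
  -- its common neighbours
  reach-inner-hub : ∀ {E} (j i k : Fin l) → toℕ i ≡ suc (toℕ j) → toℕ k ≡ suc (toℕ i) →
                    4 ≤ E (j , v j) → 4 ≤ E (k , u k) → ∀ z → Reachable E (i , z)
  reach-inner-hub {E} j i k i≡1+j k≡1+i 4≤Ev 4≤Eu z =
    dominated (SpecialPair.dominates (IsSpecial.special (special i)) z)
    where
    vj→ui : GAdj (j , v j) (i , u i)
    vj→ui = link i≡1+j
    uk→vi : GAdj (k , u k) (i , v i)
    uk→vi = link' k≡1+i
    k≢j : toℕ k ≢ toℕ j
    k≢j e = m≢1+n+m (toℕ j) {1} (trans (sym e) (trans k≡1+i (cong suc i≡1+j)))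
    k≢i : toℕ k ≢ toℕ i
    k≢i e = 1+n≢n (trans (sym k≡1+i) e)
    dominated : InS (H i) (u i) (v i) z ⊎ ∃[ s ] (InS (H i) (u i) (v i) s × Adj (H i) z s) →
                Reachable E (i , z)
    dominated (inj₁ (inj₁ refl)) = reach-adj vj→ui (≤-trans (s≤s (s≤s z≤n)) 4≤Ev)
    dominated (inj₁ (inj₂ (inj₁ refl))) = reach-adj uk→vi (≤-trans (s≤s (s≤s z≤n)) 4≤Eu)
    dominated (inj₁ (inj₂ (inj₂ (zu , _)))) = reach-within2 4≤Ev (inj₂ (inj₂ (_ , vj→ui , adjSym zu)))
    dominated (inj₂ (s , inj₁ refl , zs)) = reach-within2 4≤Ev (inj₂ (inj₂ (_ , vj→ui , adjSym zs)))
    dominated (inj₂ (s , inj₂ (inj₁ refl) , zs)) = reach-within2 4≤Eu (inj₂ (inj₂ (_ , uk→vi , adjSym zs)))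
    dominated (inj₂ (s , inj₂ (inj₂ (su , sv)) , zs)) =
      converge vj→ui (adjSym su) uk→vi (adjSym sv) (adjSym zs) 4≤Ev 4≤Eu
        (blocks-differ k≢j) (blocks-differ k≢i) (blocks-differ (≢-sym k≢i))

  anchor : Role → (i : Fin l) → Vertex (H i)
  anchor sourceV i = v i
  anchor hub     i = u i
  anchor sourceU i = u i

  pebbles : Distribution
  pebbles (i , x) = point (anchor (role (toℕ i)) i) (weight l (toℕ i)) x

  stocked : ∀ (i : Fin l) {ρ} → role (toℕ i) ≡ ρ → pebbles (i , anchor ρ i) ≡ stock ρ (suc (toℕ i) ≡ᵇ l)
  stocked i refl = point-self (anchor (role (toℕ i)) i) _

  pebbles-size : size pebbles ≡ cost l
  pebbles-size = sum-allFin l _ (weight l)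
    (λ i → sum-point (anchor (role (toℕ i)) i) (weight l (toℕ i)))

  sourceV-stock : ∀ (j : Fin l) → role (toℕ j) ≡ sourceV → 4 ≤ pebbles (j , v j)
  sourceV-stock j j-sourceV = ≤-reflexive (sym (stocked j j-sourceV))

  sourceU-stock : ∀ (k : Fin l) → role (toℕ k) ≡ sourceU → 4 ≤ pebbles (k , u k)
  sourceU-stock k k-sourceU = ≤-reflexive (sym (stocked k k-sourceU))

  last-hub-stock : ∀ (i : Fin l) → role (toℕ i) ≡ hub → suc (toℕ i) ≡ l → 2 ≤ pebbles (i , u i)
  last-hub-stock i i-hub last =
    ≤-reflexive (sym (trans (stocked i i-hub) (cong (stock hub) (Equivalence.to T-≡ (≡⇒≡ᵇ _ _ last)))))

  hub-predecessor : ∀ (i : Fin l) → role (toℕ i) ≡ hub →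
                    Σ[ j ∈ Fin l ] (toℕ i ≡ suc (toℕ j) × role (toℕ j) ≡ sourceV)
  hub-predecessor i i-hub with hub-prev (toℕ i) i-hub
  ... | p , i≡1+p , p-sourceV with blockAt (<-trans (n<1+n p) (subst (_< l) i≡1+p (toℕ<n i)))
  ...   | j , j≡p = j , trans i≡1+p (cong suc (sym j≡p)) , trans (cong role j≡p) p-sourceV

  hub-successor : ∀ (i : Fin l) → role (toℕ i) ≡ hub → suc (toℕ i) < l →
                  Σ[ k ∈ Fin l ] (toℕ k ≡ suc (toℕ i) × role (toℕ k) ≡ sourceU)
  hub-successor i i-hub 1+i<l with blockAt 1+i<l
  ... | k , k≡1+i = k , k≡1+i , trans (cong role k≡1+i) (hub-next (toℕ i) i-hub)

  reach-hub : ∀ (i : Fin l) → role (toℕ i) ≡ hub → ∀ z → Reachable pebbles (i , z)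
  reach-hub i i-hub z with hub-predecessor i i-hub | suc (toℕ i) <? l
  ... | j , i≡1+j , j-sourceV | no 1+i≮l =
    reach-last-hub j i i≡1+j (sourceV-stock j j-sourceV)
      (last-hub-stock i i-hub (≤-antisym (toℕ<n i) (≮⇒≥ 1+i≮l))) z
  ... | j , i≡1+j , j-sourceV | yes 1+i<l =
    let k , k≡1+i , k-sourceU = hub-successor i i-hub 1+i<l in
    reach-inner-hub j i k i≡1+j k≡1+i (sourceV-stock j j-sourceV) (sourceU-stock k k-sourceU) z

  pebbles-solvable : Solvable pebbles
  pebbles-solvable (i , z) with role (toℕ i) in i-role
  ... | sourceV = reach-block i (v i) z (sourceV-stock i i-role)
  ... | sourceU = reach-block i (u i) z (sourceU-stock i i-role)
  ... | hub     = reach-hub i i-role z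

-- The distribution on G_{3k+r} has size exactly bound k r (the
-- construction does not need k ≥ 1).
claim2 : (k : ℕ) → 1 ≤ k → (r : Fin 3) →
    (H : Fin (3 * k + toℕ r) → Graph) →
    (u v : (i : Fin (3 * k + toℕ r)) → Vertex (H i)) →
    (∀ i → IsSpecial (H i) (u i) (v i)) →
    Chain.OptPebLe H u v (bound k r)
claim2 k _ r H u v special =
  pebbles , pebbles-solvable , ≤-reflexive (trans pebbles-size (cost-bound k r))
  where open ChainPebbling H u v special
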